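{- Let $\Gamma=(V,H)$ be an oriented hypergraph with no vertex of degree zero and normalized Laplacian $L$. If $i$ and $j$ are duplicate vertices and $f$ is an eigenfunction of $L$ for an eigenvalue $\lambda\neq 1$, then $$f(i)=\frac{\deg(j)}{\deg(i)}f(j).$$
   Context: An oriented hypergraph is a pair $\Gamma=(V,H)$ where $V$ is a finite vertex set and each hyperedge $h\in H$ is a pair $(h_{in},h_{out})$ of disjoint subsets of $V$; $h$ is identified with $h_{in}\cup h_{out}$. Two vertices of $h$ are co-oriented in $h$ if they lie in the same one of $h_{in},h_{out}$, anti-oriented otherwise. $\deg(i)$ is the number of hyperedges containing $i$; $D$ is the diagonal degree matrix. The adjacency matrix $A$ has $A_{ii}=0$ and, for $i\neq j$, $A_{ij}=\#\{h: i,j \text{ anti-oriented in } h\}-\#\{h: i,j\text{ co-oriented in } h\}$. The normalized Laplacian is $L=\mathrm{Id}-D^{ -1}A$, i.e. $Lf(i)=f(i)-\frac{1}{\deg(i)}\sum_{j\neq i}A_{ij}f(j)$ for $f:V\to\mathbb{R}$. Vertices $i,j$ are duplicate vertices if $A_{il}=A_{jl}$ for all $l\in V$. -}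

module Defs where

open import Level using (Level; _⊔_)
open import Data.Nat as ℕ using (ℕ)
open import Data.Integer as ℤ using (ℤ; +_; -[1+_])
open import Data.Fin using (Fin; zero; suc)
open import Data.Fin.Properties using (_≟_)
open import Data.Fin.Subset using (Subset; _∈_)
open import Data.Fin.Subset.Properties using (_∈?_)
open import Data.Product using (_×_)
open import Relation.Nullary using (¬_; Dec; yes; no)
open import Algebra.Bundles using (CommutativeRing)

record Field (c ℓ : Level) : Set (Level.suc (c ⊔ ℓ)) where
  field
    commutativeRing : CommutativeRing c ℓ
  open CommutativeRing commutativeRing public
  field
    _⁻¹      : Carrier → Carrier
    1≉0      : ¬ (1# ≈ 0#)
    ⁻¹-inverse : ∀ x → ¬ (x ≈ 0#) → (x * (x ⁻¹)) ≈ 1#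

module FieldOps {c ℓ} (F : Field c ℓ) where
  open Field F using (Carrier; _≈_; _+_; -_; 0#; 1#)

  ⟦_⟧ℕ : ℕ → Carrier
  ⟦ ℕ.zero ⟧ℕ  = 0#
  ⟦ ℕ.suc n ⟧ℕ = 1# + ⟦ n ⟧ℕ

  ⟦_⟧ℤ : ℤ → Carrier
  ⟦ + n ⟧ℤ     = ⟦ n ⟧ℕ
  ⟦ -[1+ n ] ⟧ℤ = - ⟦ ℕ.suc n ⟧ℕ

  CharZero : Set ℓ
  CharZero = ∀ (k : ℕ) → ¬ (⟦ ℕ.suc k ⟧ℕ ≈ 0#)

  Σ : ∀ {n} → (Fin n → Carrier) → Carrier
  Σ {ℕ.zero}  g = 0#
  Σ {ℕ.suc n} g = g zero + Σ (λ i → g (suc i))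

record Hyperedge (n : ℕ) : Set where
  field
    hin  : Subset n
    hout : Subset n
    disjoint : ∀ (i : Fin n) → ¬ (i ∈ hin × i ∈ hout)
open Hyperedge public

record OrientedHypergraph (n : ℕ) : Set where
  field
    m : ℕ
    edge : Fin m → Hyperedge n
open OrientedHypergraph public

count : ∀ {m} {P : Fin m → Set} → (∀ k → Dec (P k)) → ℕ
count {ℕ.zero}  P? = 0
count {ℕ.suc m} P? with P? zero
... | yes _ = ℕ.suc (count (λ k → P? (suc k)))
... | no  _ = count (λ k → P? (suc k))

module _ {n : ℕ} (Γ : OrientedHypergraph n) where

  _∈ₕ_ : Fin n → Hyperedge n → Set
  i ∈ₕ h = Data.Sum._⊎_ (i ∈ hin h) (i ∈ hout h)
    where import Data.Sum

  _∈ₕ?_ : ∀ i h → Dec (i ∈ₕ h)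
  i ∈ₕ? h with i ∈? hin h | i ∈? hout h
  ... | yes p | _     = yes (Data.Sum.inj₁ p) where import Data.Sum
  ... | no _  | yes q = yes (Data.Sum.inj₂ q) where import Data.Sum
  ... | no ¬p | no ¬q = no λ { (Data.Sum.inj₁ p) → ¬p p ; (Data.Sum.inj₂ q) → ¬q q }
    where import Data.Sum

  CoOriented : Fin n → Fin n → Hyperedge n → Set
  CoOriented i j h = Data.Sum._⊎_ (i ∈ hin h × j ∈ hin h) (i ∈ hout h × j ∈ hout h)
    where import Data.Sum

  AntiOriented : Fin n → Fin n → Hyperedge n → Set
  AntiOriented i j h = Data.Sum._⊎_ (i ∈ hin h × j ∈ hout h) (i ∈ hout h × j ∈ hin h)
    where import Data.Sum

  open import Relation.Nullary.Decidable using (_×-dec_; _⊎-dec_)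

  CoOriented? : ∀ i j h → Dec (CoOriented i j h)
  CoOriented? i j h = ((i ∈? hin h) ×-dec (j ∈? hin h)) ⊎-dec ((i ∈? hout h) ×-dec (j ∈? hout h))

  AntiOriented? : ∀ i j h → Dec (AntiOriented i j h)
  AntiOriented? i j h = ((i ∈? hin h) ×-dec (j ∈? hout h)) ⊎-dec ((i ∈? hout h) ×-dec (j ∈? hin h))

  deg : Fin n → ℕ
  deg i = count (λ k → i ∈ₕ? edge Γ k)

  adj : Fin n → Fin n → ℤ
  adj i j with i ≟ j
  ... | yes _ = + 0
  ... | no  _ = (+ count (λ k → AntiOriented? i j (edge Γ k)))
                ℤ.- (+ count (λ k → CoOriented? i j (edge Γ k)))

  Duplicate : Fin n → Fin n → Set
  Duplicate i j = ∀ l → adj i l ≡ adj j l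
    where open import Relation.Binary.PropositionalEquality using (_≡_)

  module _ {c ℓ} (F : Field c ℓ) where
    open Field F using (Carrier; _≈_; _*_; _-_; _⁻¹; 0#)
    open FieldOps F using (⟦_⟧ℕ; ⟦_⟧ℤ; Σ)

    -- normalized Laplacian L = Id - D⁻¹ A acting on f : V → F
    -- (Lf)(i) = f(i) - (1/deg i) Σ_{j ≠ i} A_ij f(j); the j = i term vanishes as A_ii = 0
    laplacian : (Fin n → Carrier) → Fin n → Carrier
    laplacian f i = f i - (⟦ deg i ⟧ℕ ⁻¹ * Σ (λ j → ⟦ adj i j ⟧ℤ * f j))

    IsEigenfunction : (Fin n → Carrier) → Carrier → Set ℓ
    IsEigenfunction f λ' = (¬ (∀ i → f i ≈ 0#)) × (∀ i → laplacian f i ≈ (λ' * f i))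

-- Evaluating the eigenvalue equation at i gives Σₗ A_il f(l) = deg(i) (1 - λ) f(i).
-- Duplicate vertices have the same row of A, so the left-hand sides at i and j
-- agree; cancelling the nonzero factor 1 - λ leaves deg(i) f(i) = deg(j) f(j).
module Submission where

open import Defs
open import Level using (Level)
open import Data.Nat using (ℕ; _≥_; s≤s)
open import Data.Fin using (Fin; zero; suc)
open import Data.Product using (_,_)
open import Relation.Nullary using (¬_)
open import Relation.Binary.PropositionalEquality using (cong)
import Algebra.Properties.Ring as RingProperties
import Algebra.Properties.AbelianGroup as AbelianGroupProperties
import Algebra.Properties.Group as GroupProperties
import Algebra.Properties.CommutativeSemigroup as CommutativeSemigroupProperties
import Relation.Binary.Reasoning.Setoid as SetoidReasoning

module FieldProperties {c ℓ : Level} (F : Field c ℓ) where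
  open Field F hiding (zero)
  open FieldOps F
  open SetoidReasoning setoid
  open RingProperties ring using (-‿distribˡ-*)
  open AbelianGroupProperties +-abelianGroup using (⁻¹-anti-homo‿-; xyx⁻¹≈y)
  open GroupProperties +-group using (x∙y⁻¹≈ε⇒x≈y)

  ⁻¹-inverseˡ : ∀ x → ¬ (x ≈ 0#) → (x ⁻¹ * x) ≈ 1#
  ⁻¹-inverseˡ x x≉0 = trans (*-comm _ _) (⁻¹-inverse x x≉0)

  ⁻¹-cancelˡ : ∀ x y → ¬ (x ≈ 0#) → (x ⁻¹ * (x * y)) ≈ y
  ⁻¹-cancelˡ x y x≉0 = begin
    x ⁻¹ * (x * y)  ≈⟨ sym (*-assoc _ _ _) ⟩
    x ⁻¹ * x * y    ≈⟨ *-congʳ (⁻¹-inverseˡ x x≉0) ⟩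
    1# * y          ≈⟨ *-identityˡ y ⟩
    y               ∎

  ⁻¹-cancelʳ : ∀ x y → ¬ (x ≈ 0#) → (x * (x ⁻¹ * y)) ≈ y
  ⁻¹-cancelʳ x y x≉0 = begin
    x * (x ⁻¹ * y)  ≈⟨ sym (*-assoc _ _ _) ⟩
    x * x ⁻¹ * y    ≈⟨ *-congʳ (⁻¹-inverse x x≉0) ⟩
    1# * y          ≈⟨ *-identityˡ y ⟩
    y               ∎

  *-cancelˡ : ∀ x y z → ¬ (x ≈ 0#) → (x * y) ≈ (x * z) → y ≈ z
  *-cancelˡ x y z x≉0 xy≈xz = begin
    y               ≈⟨ sym (⁻¹-cancelˡ x y x≉0) ⟩
    x ⁻¹ * (x * y)  ≈⟨ *-congˡ xy≈xz ⟩
    x ⁻¹ * (x * z)  ≈⟨ ⁻¹-cancelˡ x z x≉0 ⟩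
    z               ∎

  *-moveˡ : ∀ x y z → ¬ (x ≈ 0#) → (x * y) ≈ z → y ≈ (x ⁻¹ * z)
  *-moveˡ x y z x≉0 xy≈z = trans (sym (⁻¹-cancelˡ x y x≉0)) (*-congˡ xy≈z)

  1-x≉0 : ∀ x → ¬ (x ≈ 1#) → ¬ ((1# - x) ≈ 0#)
  1-x≉0 x x≉1 1-x≈0 = x≉1 (sym (x∙y⁻¹≈ε⇒x≈y 1# x 1-x≈0))

  [1-x]*y≈y-x*y : ∀ x y → ((1# - x) * y) ≈ (y - x * y)
  [1-x]*y≈y-x*y x y = begin
    (1# - x) * y     ≈⟨ distribʳ y 1# (- x) ⟩
    1# * y + - x * y ≈⟨ +-cong (*-identityˡ y) (sym (-‿distribˡ-* x y)) ⟩
    y - x * y        ∎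

  x-[x-y]≈y : ∀ x y → (x - (x - y)) ≈ y
  x-[x-y]≈y x y = trans (+-congˡ (⁻¹-anti-homo‿- x y)) (trans (sym (+-assoc _ _ _)) (xyx⁻¹≈y x y))

  ⟦⟧ℕ-≉0 : CharZero → ∀ m → m ≥ 1 → ¬ (⟦ m ⟧ℕ ≈ 0#)
  ⟦⟧ℕ-≉0 charZero (ℕ.suc k) (s≤s _) = charZero k

  Σ-cong : ∀ {n} {g h : Fin n → Carrier} → (∀ k → g k ≈ h k) → Σ g ≈ Σ h
  Σ-cong {ℕ.zero}  g≈h = refl
  Σ-cong {ℕ.suc n} g≈h = +-cong (g≈h zero) (Σ-cong (λ k → g≈h (suc k)))

module Eigenfunctions {c ℓ : Level} (F : Field c ℓ) {n : ℕ} (Γ : OrientedHypergraph n) where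
  open Field F
  open FieldOps F
  open FieldProperties F
  open CommutativeSemigroupProperties *-commutativeSemigroup using (x∙yz≈y∙xz)
  open SetoidReasoning setoid

  adjacencySum : (Fin n → Carrier) → Fin n → Carrier
  adjacencySum f i = Σ (λ l → ⟦ adj Γ i l ⟧ℤ * f l)

  duplicate⇒adjacencySum≈ : ∀ i j → Duplicate Γ i j → ∀ f → adjacencySum f i ≈ adjacencySum f j
  duplicate⇒adjacencySum≈ i j dup f = Σ-cong (λ l → reflexive (cong (λ a → ⟦ a ⟧ℤ * f l) (dup l)))

  eigenvalue-equation⇒adjacencySum : ∀ f λ' i → ¬ (⟦ deg Γ i ⟧ℕ ≈ 0#) →
    laplacian Γ F f i ≈ (λ' * f i) →
    adjacencySum f i ≈ (⟦ deg Γ i ⟧ℕ * ((1# - λ') * f i))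
  eigenvalue-equation⇒adjacencySum f λ' i d≉0 Lf≈λf = begin
    S                       ≈⟨ sym (⁻¹-cancelʳ d S d≉0) ⟩
    d * (d ⁻¹ * S)          ≈⟨ *-congˡ d⁻¹S≈[1-λ]a ⟩
    d * ((1# - λ') * a)     ∎
    where
    a d S : Carrier
    a = f i
    d = ⟦ deg Γ i ⟧ℕ
    S = adjacencySum f i
    d⁻¹S≈[1-λ]a : (d ⁻¹ * S) ≈ ((1# - λ') * a)
    d⁻¹S≈[1-λ]a = begin
      d ⁻¹ * S              ≈⟨ sym (x-[x-y]≈y a (d ⁻¹ * S)) ⟩
      a - (a - d ⁻¹ * S)    ≈⟨ +-congˡ (-‿cong Lf≈λf) ⟩
      a - λ' * a            ≈⟨ sym ([1-x]*y≈y-x*y λ' a) ⟩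
      (1# - λ') * a         ∎

  duplicate⇒deg*f≈deg*f : ∀ f λ' i j → ¬ (λ' ≈ 1#) →
    ¬ (⟦ deg Γ i ⟧ℕ ≈ 0#) → ¬ (⟦ deg Γ j ⟧ℕ ≈ 0#) → Duplicate Γ i j →
    (∀ v → laplacian Γ F f v ≈ (λ' * f v)) →
    (⟦ deg Γ i ⟧ℕ * f i) ≈ (⟦ deg Γ j ⟧ℕ * f j)
  duplicate⇒deg*f≈deg*f f λ' i j λ≉1 dᵢ≉0 dⱼ≉0 dup Lf≈λf =
    *-cancelˡ (1# - λ') _ _ (1-x≉0 λ' λ≉1) (begin
      (1# - λ') * (dᵢ * f i)   ≈⟨ x∙yz≈y∙xz _ _ _ ⟩
      dᵢ * ((1# - λ') * f i)   ≈⟨ sym (eigenvalue-equation⇒adjacencySum f λ' i dᵢ≉0 (Lf≈λf i)) ⟩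
      adjacencySum f i         ≈⟨ duplicate⇒adjacencySum≈ i j dup f ⟩
      adjacencySum f j         ≈⟨ eigenvalue-equation⇒adjacencySum f λ' j dⱼ≉0 (Lf≈λf j) ⟩
      dⱼ * ((1# - λ') * f j)   ≈⟨ x∙yz≈y∙xz _ _ _ ⟩
      (1# - λ') * (dⱼ * f j)   ∎)
    where
    dᵢ dⱼ : Carrier
    dᵢ = ⟦ deg Γ i ⟧ℕ
    dⱼ = ⟦ deg Γ j ⟧ℕ

lemma5 : ∀ {c ℓ} (F : Field c ℓ) → FieldOps.CharZero F →
    ∀ {n : ℕ} (Γ : OrientedHypergraph n) →
    (∀ (v : Fin n) → deg Γ v ≥ 1) →
    ∀ (i j : Fin n) → Duplicate Γ i j →
    ∀ (f : Fin n → Field.Carrier F) (λ' : Field.Carrier F) →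
    IsEigenfunction Γ F f λ' → ¬ (Field._≈_ F λ' (Field.1# F)) →
    Field._≈_ F (f i)
    (Field._*_ F (Field._*_ F (FieldOps.⟦_⟧ℕ F (deg Γ j)) (Field._⁻¹ F (FieldOps.⟦_⟧ℕ F (deg Γ i)))) (f j))
lemma5 F charZero Γ deg≥1 i j dup f λ' (_ , Lf≈λf) λ≉1 = begin
  f i                  ≈⟨ *-moveˡ dᵢ (f i) (dⱼ * f j) (deg≉0 i) dᵢfᵢ≈dⱼfⱼ ⟩
  dᵢ ⁻¹ * (dⱼ * f j)   ≈⟨ sym (*-assoc _ _ _) ⟩
  dᵢ ⁻¹ * dⱼ * f j     ≈⟨ *-congʳ (*-comm _ _) ⟩
  dⱼ * dᵢ ⁻¹ * f j     ∎
  where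
  open Field F
  open FieldOps F
  open FieldProperties F
  open SetoidReasoning setoid
  dᵢ dⱼ : Carrier
  dᵢ = ⟦ deg Γ i ⟧ℕ
  dⱼ = ⟦ deg Γ j ⟧ℕ
  deg≉0 : ∀ v → ¬ (⟦ deg Γ v ⟧ℕ ≈ 0#)
  deg≉0 v = ⟦⟧ℕ-≉0 charZero (deg Γ v) (deg≥1 v)
  dᵢfᵢ≈dⱼfⱼ : (dᵢ * f i) ≈ (dⱼ * f j)
  dᵢfᵢ≈dⱼfⱼ = Eigenfunctions.duplicate⇒deg*f≈deg*f F Γ f λ' i j λ≉1 (deg≉0 i) (deg≉0 j) dup Lf≈λf
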